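{- For any $x\in{\sf V}$ and $N\in\mathbb{N}$, \[ |\Theta_N(x)|\le \max_{\vartheta\in\Theta_N(x)}\exp\Big(\sum_{y\in{\sf V}_\vartheta} n(y)\log n(y)\Big). \]
   Context: ${\sf G}=({\sf V},{\sf E})$ is a countably infinite simple graph without loops in which every vertex $x$ has finite degree $n(x)$. A path is a finite sequence $\vartheta=\{x_0,\dots,x_n\}$ of vertices (not necessarily distinct) with $x_{k+1}\sim x_k$; its length is $n$. ${\sf V}_\vartheta$ is the set of vertices occurring in $\vartheta$. $\Theta_N(x)$ is the set of paths $\{x,x_1,\dots,x_N\}$ of length $N$ originating at $x$ such that for all vertices $y,z$ the number of indices $k$ with $x_k=y$, $x_{k+1}=z$ is at most one. -}

module Defs where

open import Data.Nat using (ℕ; zero; suc; _^_; _≤_; _⊔_)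
import Data.Nat as ℕ
open import Data.Product using (_×_; _,_)
open import Data.Product.Properties using (≡-dec)
open import Data.List using (List; []; _∷_; length; map; filter; deduplicate; foldr)
open import Data.List.Membership.Propositional using (_∈_; _∉_)
open import Data.List.Relation.Unary.Unique.Propositional using (Unique)
open import Data.List.Relation.Unary.All using (All)
open import Data.Unit using (⊤)
open import Data.Empty using (⊥)
open import Data.Nat.ListAction using (product)
open import Relation.Binary.PropositionalEquality using (_≡_)

-- A countably infinite, locally finite simple graph without loops.
-- Vertex set V = ℕ; the (finite) neighbourhood of x is the list nbrs x.
record Graph : Set where
  field
    nbrs      : ℕ → List ℕ
    nbrs-uniq : ∀ x → Unique (nbrs x)
    no-loop   : ∀ x → x ∉ nbrs x
    symm      : ∀ x y → y ∈ nbrs x → x ∈ nbrs y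

module _ (G : Graph) where
  open Graph G

  _∼_ : ℕ → ℕ → Set
  x ∼ y = y ∈ nbrs x

  deg : ℕ → ℕ
  deg x = length (nbrs x)

  IsPath : List ℕ → Set
  IsPath []           = ⊤
  IsPath (_ ∷ [])     = ⊤
  IsPath (a ∷ b ∷ xs) = (b ∼ a) × IsPath (b ∷ xs)

  steps : List ℕ → List (ℕ × ℕ)
  steps []           = []
  steps (_ ∷ [])     = []
  steps (a ∷ b ∷ xs) = (a , b) ∷ steps (b ∷ xs)

  stepCount : List ℕ → ℕ → ℕ → ℕ
  stepCount ϑ y z = length (filter (λ p → ≡-dec ℕ._≟_ ℕ._≟_ p (y , z)) (steps ϑ))

  InΘ : ℕ → ℕ → List ℕ → Set
  InΘ N x []       = ⊥
  InΘ N x (x₀ ∷ xs) =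
    (x₀ ≡ x) × (length xs ≡ N) × IsPath (x₀ ∷ xs) ×
    (∀ y z → stepCount (x₀ ∷ xs) y z ≤ 1)

  -- exp(Σ_{y ∈ V_ϑ} n(y) log n(y)) = Π_{y ∈ V_ϑ} n(y)^{n(y)}  (with 0^0 = 1)
  weight : List ℕ → ℕ
  weight ϑ = product (map (λ y → deg y ^ deg y) (deduplicate ℕ._≟_ ϑ))

  maxWeight : List (List ℕ) → ℕ
  maxWeight = foldr (λ ϑ m → weight ϑ ⊔ m) 0

-- The walks of length N from x form a tree in which a walk leaving y branches into deg y
-- children, so distinct walks satisfy the Kraft inequality Σ_ϑ 1 / branching ϑ ≤ 1, where
-- branching ϑ is the product of the degrees of the vertices the walk leaves; hence
-- |Θ| ≤ max branching.  If no ordered step is repeated, the steps leaving y go to distinct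
-- neighbours of y, so the walk leaves y at most deg y times and branching ϑ ≤ Π_y deg y ^ deg y.
module Submission where

open import Defs
open import Data.Nat using (ℕ; _≤_)
open import Data.List using (List; length)
open import Data.List.Membership.Propositional using (_∈_)
open import Data.List.Relation.Unary.Unique.Propositional using (Unique)
open import Function.Bundles using (_⇔_)

open import Data.Nat using (zero; suc; _+_; _*_; _^_; z≤n; s≤s; NonZero)
import Data.Nat as ℕ
open import Data.Nat.Properties
open import Algebra.Properties.CommutativeSemigroup *-commutativeSemigroup using (x∙yz≈yx∙z)
open import Data.Nat.ListAction using (product)
open import Data.Nat.ListAction.Properties using (product-++; product-↭)
open import Data.List using ([]; _∷_; _++_; map; filter; drop; deduplicate)
open import Data.List.Properties
  using (length-map; length-++; map-++; map-∘; map-id-local; filter-some; filter-notAll; filter-accept)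
open import Data.List.Relation.Unary.All as All using (All; []; _∷_)
open import Data.List.Relation.Unary.All.Properties as All using (all-filter)
open import Data.List.Relation.Unary.Any using (here; there)
import Data.List.Relation.Unary.Any as Any
open import Data.List.Relation.Unary.AllPairs using ([]; _∷_)
import Data.List.Relation.Unary.Unique.Propositional.Properties as Unique
open import Data.List.Relation.Binary.Subset.Propositional using (_⊆_)
open import Data.List.Relation.Binary.Permutation.Propositional
  using (_↭_; ↭-refl; ↭-sym; ↭-trans; prep)
open import Data.List.Relation.Binary.Permutation.Propositional.Properties using (shift; ↭-length)
import Data.List.Relation.Binary.Permutation.Propositional.Properties as ↭
import Data.List.Relation.Binary.Sublist.Propositional.Properties as Sublist
open import Data.List.Membership.Propositional.Properties using (∈-filter⁺; ∈-deduplicate⁺)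
open import Data.Product using (_×_; _,_; proj₁; proj₂)
open import Data.Product.Properties using (≡-dec)
open import Data.Bool using (true; false)
open import Data.Empty using (⊥-elim)
open import Function using (_∘_; Equivalence)
open import Relation.Nullary using (¬_; ¬?; does)
open import Relation.Unary using (Decidable)
open import Relation.Unary.Properties using (∁?)
open import Relation.Binary.Definitions using (DecidableEquality)
open import Relation.Binary.PropositionalEquality

module _ {A : Set} {P : A → Set} (P? : Decidable P) where

  ↭-filter-++-filter-∁ : (xs : List A) → xs ↭ filter P? xs ++ filter (∁? P?) xs
  ↭-filter-++-filter-∁ [] = ↭-refl
  ↭-filter-++-filter-∁ (x ∷ xs) with does (P? x)
  ... | true  = prep x (↭-filter-++-filter-∁ xs)
  ... | false = ↭-trans (prep x (↭-filter-++-filter-∁ xs))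
                        (↭-sym (shift x (filter P? xs) (filter (∁? P?) xs)))

  product-map-filter : (f : A → ℕ) (xs : List A) →
                       product (map f xs) ≡ product (map f (filter P? xs)) * product (map f (filter (∁? P?) xs))
  product-map-filter f xs = begin
    product (map f xs)                      ≡⟨ product-↭ (↭.map⁺ f (↭-filter-++-filter-∁ xs)) ⟩
    product (map f (ys ++ zs))              ≡⟨ cong product (map-++ f ys zs) ⟩
    product (map f ys ++ map f zs)          ≡⟨ product-++ (map f ys) (map f zs) ⟩
    product (map f ys) * product (map f zs) ∎
    where
    open ≡-Reasoning
    ys = filter P? xs
    zs = filter (∁? P?) xs

  All-filter⁺-∩ : {Q : A → Set} {xs : List A} → All Q xs → All (λ a → Q a × P a) (filter P? xs)
  All-filter⁺-∩ {xs = xs} qs = All.zip (All.filter⁺ P? qs , all-filter P? xs)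

module _ {A : Set} (_≟_ : DecidableEquality A) where

  Unique-⊆⇒length≤ : {xs ys : List A} → Unique xs → xs ⊆ ys → length xs ≤ length ys
  Unique-⊆⇒length≤ {[]}     _             _        = z≤n
  Unique-⊆⇒length≤ {x ∷ xs} {ys} (x≢xs ∷ xs!) x∷xs⊆ys =
    ≤-trans (s≤s (Unique-⊆⇒length≤ xs! xs⊆ys-x)) (filter-notAll x≢? ys x∈ys)
    where
    x≢? = λ y → ¬? (x ≟ y)
    x∈ys = Any.map (λ x≡y x≢y → x≢y x≡y) (x∷xs⊆ys (here refl))
    xs⊆ys-x : xs ⊆ filter x≢? ys
    xs⊆ys-x y∈xs = ∈-filter⁺ x≢? (x∷xs⊆ys (there y∈xs)) (All.lookup x≢xs y∈xs)

  count≤1⇒Unique : (xs : List A) → (∀ a → length (filter (_≟ a) xs) ≤ 1) → Unique xs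
  count≤1⇒Unique []       _       = []
  count≤1⇒Unique (x ∷ xs) count≤1 =
    All.¬Any⇒All¬ xs x∉xs ∷ count≤1⇒Unique xs (λ a → ≤-trans (count-tail a) (count≤1 a))
    where
    count-tail : ∀ a → length (filter (_≟ a) xs) ≤ length (filter (_≟ a) (x ∷ xs))
    count-tail a with does (x ≟ a)
    ... | true  = n≤1+n _
    ... | false = ≤-refl
    x∉xs : ¬ x ∈ xs
    x∉xs x∈xs = <-irrefl refl (begin-strict
      1                               <⟨ s≤s (filter-some (_≟ x) (Any.map sym x∈xs)) ⟩
      suc (length (filter (_≟ x) xs)) ≡⟨ cong length (filter-accept (_≟ x) refl) ⟨
      length (filter (_≟ x) (x ∷ xs)) ≤⟨ count≤1 x ⟩
      1                               ∎)
      where open ≤-Reasoning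

module _ {A B : Set} (_≟_ : DecidableEquality B) (key : A → B) where

  key≟ : (b : B) → Decidable (λ a → key a ≡ b)
  key≟ b a = key a ≟ b

  fibre : B → List A → List A
  fibre b = filter (key≟ b)

  rest : B → List A → List A
  rest b = filter (∁? (key≟ b))

  keys∈-rest : ∀ {b bs} (as : List A) → All (λ a → key a ∈ b ∷ bs) as →
               All (λ a → key a ∈ bs) (rest b as)
  keys∈-rest {b} _ keys∈ =
    All.map (λ (k∈b∷bs , k≢b) → Any.tail k≢b k∈b∷bs) (All-filter⁺-∩ (∁? (key≟ b)) keys∈)

  weighted-pigeonhole : (k M : ℕ) (bs : List B) (as : List A) → All (λ a → key a ∈ bs) as →
                        (∀ b → k * length (fibre b as) ≤ M) → k * length as ≤ length bs * M
  weighted-pigeonhole k M []       []      _        _      = ≤-reflexive (*-zeroʳ k)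
  weighted-pigeonhole k M []       (_ ∷ _) (() ∷ _) _
  weighted-pigeonhole k M (b ∷ bs) as      keys∈    fibre≤ = begin
    k * length as                                    ≡⟨ cong (k *_) (↭-length (↭-filter-++-filter-∁ (key≟ b) as)) ⟩
    k * length (fibre b as ++ rest b as)             ≡⟨ cong (k *_) (length-++ (fibre b as)) ⟩
    k * (length (fibre b as) + length (rest b as))   ≡⟨ *-distribˡ-+ k _ _ ⟩
    k * length (fibre b as) + k * length (rest b as) ≤⟨ +-mono-≤ (fibre≤ b) rest-bound ⟩
    M + length bs * M                                ∎
    where
    open ≤-Reasoning
    rest-fibre≤ : ∀ b′ → k * length (fibre b′ (rest b as)) ≤ M
    rest-fibre≤ b′ = ≤-trans (*-monoʳ-≤ k (Sublist.length-mono-≤ fibre-rest⊆fibre)) (fibre≤ b′)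
      where
      fibre-rest⊆fibre = Sublist.filter⁺ _ _ (λ { refl p → p }) (Sublist.filter-⊆ (∁? (key≟ b)) as)
    rest-bound : k * length (rest b as) ≤ length bs * M
    rest-bound = weighted-pigeonhole k M bs (rest b as) (keys∈-rest as keys∈) rest-fibre≤

Unique-map⁺-retract : {A B : Set} {g : A → B} (f : B → A) {xs : List A} →
                      All (λ a → f (g a) ≡ a) xs → Unique xs → Unique (map g xs)
Unique-map⁺-retract f {xs} f∘g≗id xs! =
  Unique.map⁻ {f = f} (subst Unique (trans (sym (map-id-local f∘g≗id)) (map-∘ xs)) xs!)

product-map-const : {A : Set} (f : A → ℕ) {c : ℕ} {xs : List A} →
                    All (λ a → f a ≡ c) xs → product (map f xs) ≡ c ^ length xs
product-map-const f     []           = refl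
product-map-const f {c} (refl ∷ f≡c) = cong (c *_) (product-map-const f f≡c)

m^k≤m^m : ∀ {m k} → k ≤ m → m ^ k ≤ m ^ m
m^k≤m^m {zero}  z≤n = ≤-refl
m^k≤m^m {suc m} k≤m = ^-monoʳ-≤ (suc m) k≤m

∈⇒NonZero-length : {A : Set} {a : A} {xs : List A} → a ∈ xs → NonZero (length xs)
∈⇒NonZero-length (here _)  = _
∈⇒NonZero-length (there _) = _

module _ (G : Graph) where
  open Graph G

  data Walk : ℕ → ℕ → List ℕ → Set where
    [_] : ∀ x → Walk 0 x (x ∷ [])
    _◅_ : ∀ {N x y ys} → y ∈ nbrs x → Walk N y (y ∷ ys) → Walk (suc N) x (x ∷ y ∷ ys)

  IsPath⇒Walk : ∀ x xs → IsPath G (x ∷ xs) → Walk (length xs) x (x ∷ xs)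
  IsPath⇒Walk x []       _                 = [ x ]
  IsPath⇒Walk x (y ∷ xs) (x∈nbrs-y , path) = symm y x x∈nbrs-y ◅ IsPath⇒Walk y xs path

  -- The value 0 is junk: second is only applied to walks of positive length.
  second : List ℕ → ℕ
  second (_ ∷ y ∷ _) = y
  second _           = 0

  Walk-∷-drop : ∀ {N x ϑ} → Walk N x ϑ → x ∷ drop 1 ϑ ≡ ϑ
  Walk-∷-drop [ _ ]   = refl
  Walk-∷-drop (_ ◅ _) = refl

  Walk-second∈nbrs : ∀ {N x ϑ} → Walk (suc N) x ϑ → second ϑ ∈ nbrs x
  Walk-second∈nbrs (y∈nbrs-x ◅ _) = y∈nbrs-x

  Walk-drop : ∀ {N x y ϑ} → Walk (suc N) x ϑ → second ϑ ≡ y → Walk N y (drop 1 ϑ)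
  Walk-drop (_ ◅ w) refl = w

  branching : List ℕ → ℕ
  branching ϑ = product (map (deg G ∘ proj₁) (steps G ϑ))

  branching-drop : ∀ {N x ϑ} → Walk (suc N) x ϑ → branching ϑ ≡ deg G x * branching (drop 1 ϑ)
  branching-drop (_ ◅ _) = refl

  -- Division-free form of the Kraft inequality Σ_{ϑ ∈ Θ} 1 / branching ϑ ≤ 1.
  kraft : ∀ {N x} (k M : ℕ) (Θ : List (List ℕ)) → Unique Θ → All (Walk N x) Θ →
          All (λ ϑ → k * branching ϑ ≤ M) Θ → k * length Θ ≤ M
  kraft k M []          _                _                   _          = subst (_≤ M) (sym (*-zeroʳ k)) z≤n
  kraft k M (_ ∷ [])    _                ([ _ ] ∷ [])        (k≤M ∷ []) = k≤M
  kraft k M (_ ∷ _ ∷ _) ((ϑ≢ϑ′ ∷ _) ∷ _) ([ _ ] ∷ [ _ ] ∷ _) _          = ⊥-elim (ϑ≢ϑ′ refl)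
  kraft {suc N} {x} k M Θ@(_ ∷ _) Θ! walks@(w ∷ _) bounds =
    *-cancelˡ-≤ (deg G x) {{∈⇒NonZero-length (Walk-second∈nbrs w)}} (begin
      deg G x * (k * length Θ) ≡⟨ x∙yz≈yx∙z (deg G x) k (length Θ) ⟩
      k * deg G x * length Θ   ≤⟨ weighted-pigeonhole ℕ._≟_ second (k * deg G x) M (nbrs x) Θ
                                    (All.map Walk-second∈nbrs walks) fibre-bound ⟩
      deg G x * M              ∎)
    where
    open ≤-Reasoning
    tail-bound : ∀ {ϑ} → Walk (suc N) x ϑ × k * branching ϑ ≤ M → k * deg G x * branching (drop 1 ϑ) ≤ M
    tail-bound (w , k*b≤M) = subst (_≤ M) (trans (cong (k *_) (branching-drop w)) (sym (*-assoc k _ _))) k*b≤M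
    fibre-bound : ∀ y → k * deg G x * length (fibre ℕ._≟_ second y Θ) ≤ M
    fibre-bound y = subst (λ n → k * deg G x * n ≤ M) (length-map (drop 1) F)
                      (kraft (k * deg G x) M (map (drop 1) F) tails! tail-walks tail-bounds)
      where
      second≟y = key≟ ℕ._≟_ second y
      F = fibre ℕ._≟_ second y Θ
      tails! : Unique (map (drop 1) F)
      tails! = Unique-map⁺-retract (x ∷_) (All.map Walk-∷-drop (All.filter⁺ second≟y walks))
                 (Unique.filter⁺ second≟y Θ!)
      tail-walks : All (Walk N y) (map (drop 1) F)
      tail-walks = All.map⁺ (All.map (λ (w , second≡y) → Walk-drop w second≡y) (All-filter⁺-∩ second≟y walks))
      tail-bounds : All (λ τ → k * deg G x * branching τ ≤ M) (map (drop 1) F)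
      tail-bounds = All.map⁺ (All.map tail-bound (All.filter⁺ second≟y (All.zip (walks , bounds))))

  steps-source∈ : ∀ ϑ → All (λ s → proj₁ s ∈ ϑ) (steps G ϑ)
  steps-source∈ []          = []
  steps-source∈ (_ ∷ [])    = []
  steps-source∈ (_ ∷ y ∷ ϑ) = here refl ∷ All.map there (steps-source∈ (y ∷ ϑ))

  steps-target∈nbrs : ∀ ϑ → IsPath G ϑ → All (λ s → proj₂ s ∈ nbrs (proj₁ s)) (steps G ϑ)
  steps-target∈nbrs []          _                 = []
  steps-target∈nbrs (_ ∷ [])    _                 = []
  steps-target∈nbrs (x ∷ y ∷ ϑ) (x∈nbrs-y , path) =
    symm y x x∈nbrs-y ∷ steps-target∈nbrs (y ∷ ϑ) path

  distinct-steps-from-bound : ∀ u (S : List (ℕ × ℕ)) → Unique S → All (λ s → proj₁ s ≡ u) S →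
                              All (λ s → proj₂ s ∈ nbrs (proj₁ s)) S →
                              product (map (deg G ∘ proj₁) S) ≤ deg G u ^ deg G u
  distinct-steps-from-bound u S S! from-u targets∈ = begin
    product (map (deg G ∘ proj₁) S) ≡⟨ product-map-const (deg G ∘ proj₁) (All.map (cong (deg G)) from-u) ⟩
    deg G u ^ length S              ≡⟨ cong (deg G u ^_) (length-map proj₂ S) ⟨
    deg G u ^ length (map proj₂ S)  ≤⟨ m^k≤m^m (Unique-⊆⇒length≤ ℕ._≟_ targets! targets⊆nbrs-u) ⟩
    deg G u ^ deg G u               ∎
    where
    open ≤-Reasoning
    targets! : Unique (map proj₂ S)
    targets! = Unique-map⁺-retract (u ,_) (All.map (λ { refl → refl }) from-u) S!
    targets⊆nbrs-u : map proj₂ S ⊆ nbrs u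
    targets⊆nbrs-u = All.lookup (All.map⁺ (All.zipWith (λ { (t∈ , refl) → t∈ }) (targets∈ , from-u)))

  distinct-steps-bound : (U : List ℕ) (S : List (ℕ × ℕ)) → Unique S →
                         All (λ s → proj₁ s ∈ U) S → All (λ s → proj₂ s ∈ nbrs (proj₁ s)) S →
                         product (map (deg G ∘ proj₁) S) ≤ product (map (λ u → deg G u ^ deg G u) U)
  distinct-steps-bound []      []      _  _        _ = ≤-refl
  distinct-steps-bound []      (_ ∷ _) _  (() ∷ _) _
  distinct-steps-bound (u ∷ U) S       S! sources∈ targets∈ = begin
    product (map (deg G ∘ proj₁) S)                      ≡⟨ product-map-filter from-u? (deg G ∘ proj₁) S ⟩
    product (map (deg G ∘ proj₁) (fibre ℕ._≟_ proj₁ u S)) *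
    product (map (deg G ∘ proj₁) (rest ℕ._≟_ proj₁ u S)) ≤⟨ *-mono-≤ from-u-bound rest-bound ⟩
    deg G u ^ deg G u * product (map (λ u → deg G u ^ deg G u) U) ∎
    where
    open ≤-Reasoning
    from-u? = key≟ ℕ._≟_ proj₁ u
    from-u-bound = distinct-steps-from-bound u (fibre ℕ._≟_ proj₁ u S) (Unique.filter⁺ from-u? S!)
                     (all-filter from-u? S) (All.filter⁺ from-u? targets∈)
    rest-bound = distinct-steps-bound U (rest ℕ._≟_ proj₁ u S) (Unique.filter⁺ (∁? from-u?) S!)
                   (keys∈-rest ℕ._≟_ proj₁ S sources∈) (All.filter⁺ (∁? from-u?) targets∈)

  branching≤weight : ∀ ϑ → IsPath G ϑ → (∀ y z → stepCount G ϑ y z ≤ 1) → branching ϑ ≤ weight G ϑ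
  branching≤weight ϑ path count≤1 =
    distinct-steps-bound (deduplicate ℕ._≟_ ϑ) (steps G ϑ)
      (count≤1⇒Unique (≡-dec ℕ._≟_ ℕ._≟_) (steps G ϑ) (λ (y , z) → count≤1 y z))
      (All.map (∈-deduplicate⁺ ℕ._≟_) (steps-source∈ ϑ)) (steps-target∈nbrs ϑ path)

weight≤maxWeight : (G : Graph) {ϑ : List ℕ} {Θ : List (List ℕ)} → ϑ ∈ Θ → weight G ϑ ≤ maxWeight G Θ
weight≤maxWeight G (here refl) = m≤m⊔n _ _
weight≤maxWeight G (there ϑ∈Θ) = ≤-trans (weight≤maxWeight G ϑ∈Θ) (m≤n⊔m _ _)

lemma11 : (G : Graph) (x N : ℕ) (Θ : List (List ℕ)) →
          Unique Θ → (∀ ϑ → (ϑ ∈ Θ) ⇔ InΘ G N x ϑ) →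
          length Θ ≤ maxWeight G Θ
lemma11 G x N Θ Θ! Θ⇔InΘ =
  subst (_≤ maxWeight G Θ) (*-identityˡ (length Θ)) (kraft G 1 (maxWeight G Θ) Θ Θ! walks bounds)
  where
  InΘ⇒Walk : ∀ {ϑ} → InΘ G N x ϑ → Walk G N x ϑ
  InΘ⇒Walk {x ∷ xs} (refl , refl , path , _) = IsPath⇒Walk G x xs path
  InΘ⇒branching≤weight : ∀ {ϑ} → InΘ G N x ϑ → branching G ϑ ≤ weight G ϑ
  InΘ⇒branching≤weight {ϑ@(_ ∷ _)} (_ , _ , path , count≤1) = branching≤weight G ϑ path count≤1
  walks : All (Walk G N x) Θ
  walks = All.tabulate (InΘ⇒Walk ∘ Equivalence.to (Θ⇔InΘ _))
  bounds : All (λ ϑ → 1 * branching G ϑ ≤ maxWeight G Θ) Θ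
  bounds = All.tabulate λ {ϑ} ϑ∈Θ → begin
    1 * branching G ϑ ≡⟨ *-identityˡ _ ⟩
    branching G ϑ     ≤⟨ InΘ⇒branching≤weight (Equivalence.to (Θ⇔InΘ _) ϑ∈Θ) ⟩
    weight G ϑ        ≤⟨ weight≤maxWeight G ϑ∈Θ ⟩
    maxWeight G Θ     ∎
    where open ≤-Reasoning
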